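{- Let $\Phi=\frac{1+\sqrt5}{2}$ and $p,q\in\mathbb{N}$. Then $(p,q)$ is a splitting pair if and only if there exist $m,n\in\mathbb{N}_0$ with $m<n$ such that $$(p,q)=\big(\lfloor n\Phi\rfloor-\lfloor m\Phi\rfloor,\ \lfloor n\Phi^2\rfloor-\lfloor m\Phi^2\rfloor\big).$$
   Context: A pair $(p,q)$ of positive integers is a splitting pair if there is $n\in\mathbb{N}$ with $(p,q)=(\lfloor n\Phi\rfloor,\lfloor n\Phi^2\rfloor)$ (a Wythoff pair) or $(p,q)=(\lfloor n\Phi\rfloor+1,\lfloor n\Phi^2\rfloor+1)$ (a dual Wythoff pair). -}

module Defs where

open import Data.Nat using (ℕ; zero; suc; _+_; _*_; _∸_; _≤?_; _/_)
open import Data.Product using (_×_; _,_; ∃-syntax)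
open import Data.Sum using (_⊎_)
open import Relation.Nullary using (yes; no)
open import Relation.Binary.PropositionalEquality using (_≡_)

isqrtFrom : ℕ → ℕ → ℕ
isqrtFrom N zero = zero
isqrtFrom N (suc b) with suc b * suc b ≤? N
... | yes _ = suc b
... | no  _ = isqrtFrom N b

isqrt : ℕ → ℕ
isqrt N = isqrtFrom N N

-- Φ = (1 + √5)/2.  n Φ = (n + √(5 n²)) / 2, and since n is an integer,
-- ⌊ n Φ ⌋ = ⌊ (n + ⌊√(5 n²)⌋) / 2 ⌋.
floorPhi : ℕ → ℕ
floorPhi n = (n + isqrt (5 * (n * n))) / 2

-- Φ² = Φ + 1, so ⌊ n Φ² ⌋ = ⌊ n Φ ⌋ + n.
floorPhi2 : ℕ → ℕ
floorPhi2 n = floorPhi n + n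

-- (p , q) is a splitting pair: Wythoff pair or dual Wythoff pair, n ∈ ℕ = {1,2,...}
SplittingPair : ℕ → ℕ → Set
SplittingPair p q =
  ∃[ n ] (1 Data.Nat.≤ n ×
          ((p ≡ floorPhi n × q ≡ floorPhi2 n) ⊎
           (p ≡ suc (floorPhi n) × q ≡ suc (floorPhi2 n))))

-- Write A n = ⌊n Φ⌋ = ⌊(n + ⌊n √5⌋) / 2⌋ and B n = ⌊n Φ²⌋ = A n + n. Since n ↦ ⌊n √5⌋ is
-- superadditive up to an error of at most 1, A (m + k) − A m ∈ {A k, A k + 1}, and
-- B (m + k) − B m = (A (m + k) − A m) + k; so every difference pair is a Wythoff or dual
-- Wythoff pair with index k = n − m. Conversely (A k, B k) is the difference for m = 0, and
-- (A k + 1, B k + 1) the difference for (m, n) = (A k, B k), by the classical identities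
-- A (A k) = A k + k − 1 and A (B k) = A k + B k. These follow from the characterisation
-- c ≤ A n ⇔ c² ≤ c n + n², the symmetry Φ = 1 + 1/Φ, which makes n + c ≤ c Φ equivalent to
-- c ≥ n Φ, and the irrationality of Φ, which makes c ≥ n Φ strict for n ≥ 1.

module Submission where

open import Defs
open import Data.Nat
open import Data.Nat.DivMod using (m/n*n≤m; m*n/n≡m; /-monoˡ-≤; m<n*o⇒m/o<n)
open import Data.Nat.Induction using (<-wellFounded)
open import Data.Nat.Properties
open import Data.Nat.Tactic.RingSolver using (solve-∀)
open import Data.Product using (_×_; ∃-syntax; _,_; proj₁; proj₂)
open import Data.Sum using (_⊎_; inj₁; inj₂)
open import Function.Base using (_∘_; case_of_)
open import Function.Bundles using (_⇔_; mk⇔; Equivalence)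
open import Induction.WellFounded using (Acc; acc)
open import Relation.Nullary using (¬_; yes; no; contradiction)
open import Relation.Binary.PropositionalEquality

open Equivalence using (to; from)
open import Algebra.Properties.CommutativeSemigroup +-commutativeSemigroup
  using () renaming (interchange to +-interchange)

square-cancel-≤ : ∀ {x y} → x * x ≤ y * y → x ≤ y
square-cancel-≤ x²≤y² = ≮⇒≥ λ y<x → <⇒≱ (*-mono-< y<x y<x) x²≤y²

square-cancel-< : ∀ {x y} → x * x < y * y → x < y
square-cancel-< x²<y² = ≰⇒> λ y≤x → <⇒≱ x²<y² (*-mono-≤ y≤x y≤x)

isqrtFrom-spec : ∀ N b → isqrtFrom N b * isqrtFrom N b ≤ N
  × (N < suc b * suc b → N < suc (isqrtFrom N b) * suc (isqrtFrom N b))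
isqrtFrom-spec N zero = z≤n , λ N<1 → N<1
isqrtFrom-spec N (suc b) with suc b * suc b ≤? N
... | yes b²≤N = b²≤N , λ N<b² → N<b²
... | no  b²≰N = proj₁ (isqrtFrom-spec N b) , λ _ → proj₂ (isqrtFrom-spec N b) (≰⇒> b²≰N)

isqrt[N]²≤N : ∀ N → isqrt N * isqrt N ≤ N
isqrt[N]²≤N N = proj₁ (isqrtFrom-spec N N)

N<[1+isqrt[N]]² : ∀ N → N < suc (isqrt N) * suc (isqrt N)
N<[1+isqrt[N]]² N = proj₂ (isqrtFrom-spec N N) (m≤m+n (suc N) _)

≤isqrt⇔ : ∀ {s N} → s ≤ isqrt N ⇔ s * s ≤ N
≤isqrt⇔ {s} {N} = mk⇔
  (λ s≤r → ≤-trans (*-mono-≤ s≤r s≤r) (isqrt[N]²≤N N))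
  (λ s²≤N → s≤s⁻¹ (square-cancel-< (≤-<-trans s²≤N (N<[1+isqrt[N]]² N))))

isqrt<⇒ : ∀ {t N} → N < t * t → isqrt N < t
isqrt<⇒ N<t² = ≰⇒> λ t≤r → <⇒≱ N<t² (to ≤isqrt⇔ t≤r)

⌊_*√_⌋ : ℕ → ℕ → ℕ
⌊ n *√ d ⌋ = isqrt (d * (n * n))

square-of-product : ∀ x y → (x * y) * (x * y) ≡ (x * x) * (y * y)
square-of-product = solve-∀

square-of-d-product : ∀ d m k → (d * (m * m)) * (d * (k * k)) ≡ (d * (m * k)) * (d * (m * k))
square-of-d-product = solve-∀

⌊*√⌋-product-≤ : ∀ d m k → ⌊ m *√ d ⌋ * ⌊ k *√ d ⌋ ≤ d * (m * k)
⌊*√⌋-product-≤ d m k = square-cancel-≤ (begin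
  (x * y) * (x * y)              ≡⟨ square-of-product x y ⟩
  (x * x) * (y * y)              ≤⟨ *-mono-≤ (isqrt[N]²≤N (d * (m * m))) (isqrt[N]²≤N (d * (k * k))) ⟩
  (d * (m * m)) * (d * (k * k))  ≡⟨ square-of-d-product d m k ⟩
  (d * (m * k)) * (d * (m * k))  ∎)
  where
  open ≤-Reasoning
  x = ⌊ m *√ d ⌋
  y = ⌊ k *√ d ⌋

⌊*√⌋-product-< : ∀ d m k → d * (m * k) < suc ⌊ m *√ d ⌋ * suc ⌊ k *√ d ⌋
⌊*√⌋-product-< d m k = square-cancel-< (begin-strict
  (d * (m * k)) * (d * (m * k))  ≡⟨ square-of-d-product d m k ⟨
  (d * (m * m)) * (d * (k * k))  <⟨ *-mono-< (N<[1+isqrt[N]]² (d * (m * m))) (N<[1+isqrt[N]]² (d * (k * k))) ⟩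
  (x * x) * (y * y)              ≡⟨ square-of-product x y ⟨
  (x * y) * (x * y)              ∎)
  where
  open ≤-Reasoning
  x = suc ⌊ m *√ d ⌋
  y = suc ⌊ k *√ d ⌋

binomial : ∀ x y → (x + y) * (x + y) ≡ x * x + 2 * (x * y) + y * y
binomial = solve-∀

d-binomial : ∀ d m k → d * ((m + k) * (m + k)) ≡ d * (m * m) + 2 * (d * (m * k)) + d * (k * k)
d-binomial = solve-∀

⌊*√⌋-superadditive : ∀ d m k → ⌊ m *√ d ⌋ + ⌊ k *√ d ⌋ ≤ ⌊ (m + k) *√ d ⌋
⌊*√⌋-superadditive d m k = from (≤isqrt⇔ {N = d * ((m + k) * (m + k))}) (begin
  (x + y) * (x + y)                              ≡⟨ binomial x y ⟩
  x * x + 2 * (x * y) + y * y                    ≤⟨ +-mono-≤ (+-mono-≤ x²≤ (*-monoʳ-≤ 2 (⌊*√⌋-product-≤ d m k))) y²≤ ⟩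
  d * (m * m) + 2 * (d * (m * k)) + d * (k * k)  ≡⟨ d-binomial d m k ⟨
  d * ((m + k) * (m + k))                        ∎)
  where
  open ≤-Reasoning
  x = ⌊ m *√ d ⌋
  y = ⌊ k *√ d ⌋
  x²≤ = isqrt[N]²≤N (d * (m * m))
  y²≤ = isqrt[N]²≤N (d * (k * k))

⌊*√⌋-almost-subadditive : ∀ d m k → ⌊ (m + k) *√ d ⌋ ≤ suc (⌊ m *√ d ⌋ + ⌊ k *√ d ⌋)
⌊*√⌋-almost-subadditive d m k =
  subst (⌊ (m + k) *√ d ⌋ ≤_) (+-suc x y) (s≤s⁻¹ (isqrt<⇒ {N = d * ((m + k) * (m + k))} (begin-strict
    d * ((m + k) * (m + k))                        ≡⟨ d-binomial d m k ⟩
    d * (m * m) + 2 * (d * (m * k)) + d * (k * k)  <⟨ +-mono-<-≤ (+-mono-<-≤ <x² 2xy<) (<⇒≤ <y²) ⟩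
    x' * x' + 2 * (x' * y') + y' * y'              ≡⟨ binomial x' y' ⟨
    (x' + y') * (x' + y')                          ∎)))
  where
  open ≤-Reasoning
  x = ⌊ m *√ d ⌋
  y = ⌊ k *√ d ⌋
  x' = suc x
  y' = suc y
  <x² = N<[1+isqrt[N]]² (d * (m * m))
  <y² = N<[1+isqrt[N]]² (d * (k * k))
  2xy< = *-monoʳ-≤ 2 (<⇒≤ (⌊*√⌋-product-< d m k))

≤/2⇔ : ∀ {c v} → c ≤ v / 2 ⇔ c * 2 ≤ v
≤/2⇔ {c} {v} = mk⇔
  (λ c≤v/2 → ≤-trans (*-monoˡ-≤ 2 c≤v/2) (m/n*n≤m v 2))
  (λ 2c≤v → subst (_≤ v / 2) (m*n/n≡m c 2) (/-monoˡ-≤ 2 2c≤v))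

v<[1+v/2]*2 : ∀ v → v < suc (v / 2) * 2
v<[1+v/2]*2 v = ≰⇒> λ 2[1+v/2]≤v → 1+n≰n (from ≤/2⇔ 2[1+v/2]≤v)

floorPhi*2≤ : ∀ n → floorPhi n * 2 ≤ n + ⌊ n *√ 5 ⌋
floorPhi*2≤ n = to ≤/2⇔ ≤-refl

floorPhi-superadditive : ∀ m k → floorPhi m + floorPhi k ≤ floorPhi (m + k)
floorPhi-superadditive m k = from ≤/2⇔ (begin
  (a + b) * 2                          ≡⟨ *-distribʳ-+ 2 a b ⟩
  a * 2 + b * 2                        ≤⟨ +-mono-≤ (floorPhi*2≤ m) (floorPhi*2≤ k) ⟩
  (m + ⌊ m *√ 5 ⌋) + (k + ⌊ k *√ 5 ⌋)  ≡⟨ +-interchange m ⌊ m *√ 5 ⌋ k ⌊ k *√ 5 ⌋ ⟩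
  (m + k) + (⌊ m *√ 5 ⌋ + ⌊ k *√ 5 ⌋)  ≤⟨ +-monoʳ-≤ (m + k) (⌊*√⌋-superadditive 5 m k) ⟩
  (m + k) + ⌊ (m + k) *√ 5 ⌋           ∎)
  where
  open ≤-Reasoning
  a = floorPhi m
  b = floorPhi k

floorPhi-almost-subadditive : ∀ m k → floorPhi (m + k) ≤ suc (floorPhi m + floorPhi k)
floorPhi-almost-subadditive m k = s≤s⁻¹ (m<n*o⇒m/o<n (begin-strict
  (m + k) + ⌊ (m + k) *√ 5 ⌋                 ≤⟨ +-monoʳ-≤ (m + k) (⌊*√⌋-almost-subadditive 5 m k) ⟩
  (m + k) + suc (⌊ m *√ 5 ⌋ + ⌊ k *√ 5 ⌋)    ≡⟨ rearrange m k ⌊ m *√ 5 ⌋ ⌊ k *√ 5 ⌋ ⟩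
  suc (u + v)                                <⟨ subst (_≤ suc a * 2 + suc b * 2) (cong suc (+-suc u v))
                                                  (+-mono-≤ (v<[1+v/2]*2 u) (v<[1+v/2]*2 v)) ⟩
  suc a * 2 + suc b * 2                      ≡⟨ *-distribʳ-+ 2 (suc a) (suc b) ⟨
  (suc a + suc b) * 2                        ≡⟨ cong (_* 2) (+-suc (suc a) b) ⟩
  suc (suc (a + b)) * 2                      ∎))
  where
  open ≤-Reasoning
  a = floorPhi m
  b = floorPhi k
  u = m + ⌊ m *√ 5 ⌋
  v = k + ⌊ k *√ 5 ⌋
  rearrange : ∀ m k x y → (m + k) + suc (x + y) ≡ suc ((m + x) + (k + y))
  rearrange = solve-∀

≤∧≤suc⇒≡∨≡suc : ∀ {a b} → a ≤ b → b ≤ suc a → b ≡ a ⊎ b ≡ suc a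
≤∧≤suc⇒≡∨≡suc a≤b b≤1+a with m≤n⇒m<n∨m≡n a≤b
... | inj₁ a<b = inj₂ (≤-antisym b≤1+a a<b)
... | inj₂ a≡b = inj₁ (sym a≡b)

floorPhi-almost-additive : ∀ m k →
  floorPhi (m + k) ≡ floorPhi m + floorPhi k ⊎ floorPhi (m + k) ≡ suc (floorPhi m + floorPhi k)
floorPhi-almost-additive m k =
  ≤∧≤suc⇒≡∨≡suc (floorPhi-superadditive m k) (floorPhi-almost-subadditive m k)

≡+⇒∸≡ : ∀ {x y z} → x ≡ y + z → x ∸ y ≡ z
≡+⇒∸≡ {y = y} {z} x≡y+z = trans (cong (_∸ y) x≡y+z) (m+n∸m≡n y z)

floorPhi-differences : ∀ m k {x} → floorPhi (m + k) ≡ floorPhi m + x →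
  floorPhi (m + k) ∸ floorPhi m ≡ x × floorPhi2 (m + k) ∸ floorPhi2 m ≡ x + k
floorPhi-differences m k {x} F[m+k]≡ =
    ≡+⇒∸≡ {floorPhi (m + k)} {floorPhi m} {x} F[m+k]≡
  , ≡+⇒∸≡ {floorPhi2 (m + k)} {floorPhi2 m} {x + k} (begin
      floorPhi (m + k) + (m + k)  ≡⟨ cong (_+ (m + k)) F[m+k]≡ ⟩
      (floorPhi m + x) + (m + k)  ≡⟨ +-interchange (floorPhi m) x m k ⟩
      (floorPhi m + m) + (x + k)  ∎)
  where open ≡-Reasoning

difference⇒splittingPair : ∀ {m n} → m < n →
  SplittingPair (floorPhi n ∸ floorPhi m) (floorPhi2 n ∸ floorPhi2 m)
difference⇒splittingPair {m} {n} m<n =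
  subst (λ n → SplittingPair (floorPhi n ∸ floorPhi m) (floorPhi2 n ∸ floorPhi2 m))
    (m+[n∸m]≡n (<⇒≤ m<n)) (case floorPhi-almost-additive m k of λ where
      (inj₁ F[m+k]≡) → k , 0<k , inj₁ (floorPhi-differences m k F[m+k]≡)
      (inj₂ F[m+k]≡) → k , 0<k , inj₂ (floorPhi-differences m k
                          (trans F[m+k]≡ (sym (+-suc (floorPhi m) (floorPhi k))))))
  where
  k = n ∸ m
  0<k : 0 < k
  0<k = m<n⇒0<n∸m m<n

-- c ≤Φ· n encodes c ≤ n Φ: as Φ is the positive root of x² − x − 1, for c ≥ 0 this is c² ≤ c n + n².
infix 4 _≤Φ·_
_≤Φ·_ : ℕ → ℕ → Set
c ≤Φ· n = c * c ≤ c * n + n * n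

≤⇒≤Φ· : ∀ {c n} → c ≤ n → c ≤Φ· n
≤⇒≤Φ· {c} {n} c≤n = ≤-trans (*-monoʳ-≤ c c≤n) (m≤m+n (c * n) (n * n))

-- 4 (c² − c n − n²) = (2c − n)² − 5 n²
≤Φ·⇔ : ∀ {c n u} → c * 2 ≡ n + u → (c ≤Φ· n ⇔ u * u ≤ 5 * (n * n))
≤Φ·⇔ {c} {n} {u} 2c≡n+u = mk⇔
  (λ c≤Φn → +-cancelˡ-≤ X (u * u) (5 * (n * n)) (subst₂ _≤_ 4c² 4[cn+n²] (*-monoʳ-≤ 4 c≤Φn)))
  (λ u²≤5n² → *-cancelˡ-≤ 4 (subst₂ _≤_ (sym 4c²) (sym 4[cn+n²]) (+-monoʳ-≤ X u²≤5n²)))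
  where
  open ≡-Reasoning
  X = n * n + 2 * (n * u)
  4c²≡[2c]² : ∀ c → 4 * (c * c) ≡ (c * 2) * (c * 2)
  4c²≡[2c]² = solve-∀
  4[cn+n²]≡2c·2n+4n² : ∀ c n → 4 * (c * n + n * n) ≡ (c * 2) * (2 * n) + 4 * (n * n)
  4[cn+n²]≡2c·2n+4n² = solve-∀
  [n+u]·2n+4n²≡X+5n² : ∀ n u → (n + u) * (2 * n) + 4 * (n * n) ≡ (n * n + 2 * (n * u)) + 5 * (n * n)
  [n+u]·2n+4n²≡X+5n² = solve-∀
  4c² : 4 * (c * c) ≡ X + u * u
  4c² = begin
    4 * (c * c)                      ≡⟨ 4c²≡[2c]² c ⟩
    (c * 2) * (c * 2)                ≡⟨ cong (λ t → t * t) 2c≡n+u ⟩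
    (n + u) * (n + u)                ≡⟨ binomial n u ⟩
    X + u * u                        ∎
  4[cn+n²] : 4 * (c * n + n * n) ≡ X + 5 * (n * n)
  4[cn+n²] = begin
    4 * (c * n + n * n)              ≡⟨ 4[cn+n²]≡2c·2n+4n² c n ⟩
    (c * 2) * (2 * n) + 4 * (n * n)  ≡⟨ cong (λ t → t * (2 * n) + 4 * (n * n)) 2c≡n+u ⟩
    (n + u) * (2 * n) + 4 * (n * n)  ≡⟨ [n+u]·2n+4n²≡X+5n² n u ⟩
    X + 5 * (n * n)                  ∎

≤floorPhi⇔≤Φ· : ∀ {c n} → c ≤ floorPhi n ⇔ c ≤Φ· n
≤floorPhi⇔≤Φ· {c} {n} with n ≤? c * 2
... | no n≰2c = mk⇔ (λ _ → ≤⇒≤Φ· c≤n) (λ _ → from ≤/2⇔ (≤-trans (<⇒≤ 2c<n) (m≤m+n n ⌊ n *√ 5 ⌋)))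
  where
  2c<n : c * 2 < n
  2c<n = ≰⇒> n≰2c
  c≤n : c ≤ n
  c≤n = ≤-trans (m≤m*n c 2) (<⇒≤ 2c<n)
... | yes n≤2c with m≤n⇒∃[o]m+o≡n n≤2c
...   | u , n+u≡2c = mk⇔
  (λ c≤F → from (≤Φ·⇔ {c} {n} {u} (sym n+u≡2c)) (to ≤isqrt⇔
     (+-cancelˡ-≤ n u r (subst (_≤ n + r) (sym n+u≡2c) (to ≤/2⇔ c≤F)))))
  (λ c≤Φn → from ≤/2⇔ (subst (_≤ n + r) n+u≡2c
     (+-monoʳ-≤ n (from ≤isqrt⇔ (to (≤Φ·⇔ {c} {n} {u} (sym n+u≡2c)) c≤Φn)))))
  where
  r = ⌊ n *√ 5 ⌋

floorPhi-≤Φ· : ∀ n → floorPhi n ≤Φ· n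
floorPhi-≤Φ· n = to (≤floorPhi⇔≤Φ· {floorPhi n} {n}) ≤-refl

floorPhi<⇒≰Φ· : ∀ {c n} → floorPhi n < c → ¬ c ≤Φ· n
floorPhi<⇒≰Φ· {c} {n} F<c c≤Φn = <⇒≱ F<c (from (≤floorPhi⇔≤Φ· {c} {n}) c≤Φn)

floorPhi-unique : ∀ {c n} → c ≤Φ· n → ¬ suc c ≤Φ· n → floorPhi n ≡ c
floorPhi-unique {c} {n} c≤Φn 1+c≰Φn =
  ≤-antisym (≮⇒≥ (1+c≰Φn ∘ to (≤floorPhi⇔≤Φ· {suc c} {n}))) (from (≤floorPhi⇔≤Φ· {c} {n}) c≤Φn)

-- floorPhi 1 computes to 1.
floorPhi-suc : ∀ n → floorPhi n < floorPhi (suc n)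
floorPhi-suc n = floorPhi-superadditive 1 n

-- (n + c)² − (n + c) c − c² = − (c² − c n − n²), reflecting Φ = 1 + 1/Φ.
swap-identity : ∀ c n → (n + c) * (n + c) + c * c ≡ ((n + c) * c + c * c) + (c * n + n * n)
swap-identity = solve-∀

Φ-irrational : ∀ c n → c * c ≡ c * n + n * n → n ≡ 0
Φ-irrational c n = descent c n (<-wellFounded n)
  where
  descent : ∀ c n → Acc _<_ n → c * c ≡ c * n + n * n → n ≡ 0
  descent c zero _ _ = refl
  descent c (suc n) (acc rec) c²≡ with suc n <? c
  ... | no n≮c = contradiction c²≡ (<⇒≢ (≤-<-trans (*-monoʳ-≤ c (≮⇒≥ n≮c)) (m<m+n (c * suc n) z<s)))
  ... | yes n<c with m≤n⇒∃[o]m+o≡n n<c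
  ...   | d , refl = case descent N D (rec D<N) N²≡ of λ ()
    where
    N = suc n
    D = suc d
    [D+N]²≡ : (D + N) * (D + N) ≡ (D + N) * N + N * N
    [D+N]²≡ = subst (λ c → c * c ≡ c * N + N * N) (cong suc (+-comm N d)) c²≡
    N²≡ : N * N ≡ N * D + D * D
    N²≡ = +-cancelˡ-≡ ((D + N) * N + N * N) (N * N) (N * D + D * D)
      (trans (cong (_+ N * N) (sym [D+N]²≡)) (swap-identity N D))
    D<N : D < N
    D<N = square-cancel-< (subst (D * D <_) (sym N²≡) (m<n+m (D * D) z<s))

≰Φ·⇒+≤Φ· : ∀ {c n} → ¬ c ≤Φ· n → n + c ≤Φ· c
≰Φ·⇒+≤Φ· {c} {n} c≰Φn = +-cancelʳ-≤ (c * c) ((n + c) * (n + c)) ((n + c) * c + c * c) (begin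
  (n + c) * (n + c) + c * c                ≡⟨ swap-identity c n ⟩
  ((n + c) * c + c * c) + (c * n + n * n)  ≤⟨ +-monoʳ-≤ ((n + c) * c + c * c) (<⇒≤ (≰⇒> c≰Φn)) ⟩
  ((n + c) * c + c * c) + c * c            ∎)
  where open ≤-Reasoning

+≤Φ·⇒≰Φ· : ∀ {c n} → suc n + c ≤Φ· c → ¬ c ≤Φ· suc n
+≤Φ·⇒≰Φ· {c} {n} [n+c]≤Φc c≤Φn = <⇒≢ (+-mono-≤-< [n+c]≤Φc c²<) (swap-identity c (suc n))
  where
  c²< : c * c < c * suc n + suc n * suc n
  c²< = ≤∧≢⇒< c≤Φn (λ c²≡ → case Φ-irrational c (suc n) c²≡ of λ ())

floorPhi∘floorPhi : ∀ k → floorPhi (floorPhi (suc k)) ≡ k + floorPhi (suc k)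
floorPhi∘floorPhi k = floorPhi-unique {k + a} {a}
  (≰Φ·⇒+≤Φ· {a} {k} (floorPhi<⇒≰Φ· {a} {k} (floorPhi-suc k)))
  (λ [K+a]≤Φa → +≤Φ·⇒≰Φ· {a} {k} [K+a]≤Φa (floorPhi-≤Φ· (suc k)))
  where
  a = floorPhi (suc k)

floorPhi∘floorPhi2 : ∀ k → floorPhi (floorPhi2 (suc k)) ≡ floorPhi (suc k) + floorPhi2 (suc k)
floorPhi∘floorPhi2 k = floorPhi-unique {a + b} {b} (≰Φ·⇒+≤Φ· {b} {a} b≰Φa)
  (λ [1+a+b]≤Φb → +≤Φ·⇒≰Φ· {b} {a} [1+a+b]≤Φb b≤Φ1+a)
  where
  a = floorPhi (suc k)
  b = floorPhi2 (suc k)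
  b≰Φa : ¬ b ≤Φ· a
  b≰Φa b≤Φa = +≤Φ·⇒≰Φ· {a} {k} (subst (_≤Φ· a) (+-comm a (suc k)) b≤Φa) (floorPhi-≤Φ· (suc k))
  b≤Φ1+a : b ≤Φ· suc a
  b≤Φ1+a = subst (_≤Φ· suc a) (trans (+-comm k (suc a)) (sym (+-suc a k)))
    (≰Φ·⇒+≤Φ· {suc a} {k} (floorPhi<⇒≰Φ· {suc a} {k} (m<n⇒m<1+n (floorPhi-suc k))))

dualWythoffPair-difference : ∀ k → let a = floorPhi (suc k) ; b = floorPhi2 (suc k) in
  suc a ≡ floorPhi b ∸ floorPhi a × suc b ≡ floorPhi2 b ∸ floorPhi2 a
dualWythoffPair-difference k =
    sym (≡+⇒∸≡ {floorPhi b} {floorPhi a} {suc a} (begin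
      floorPhi b                ≡⟨ floorPhi∘floorPhi2 k ⟩
      a + b                     ≡⟨ p-identity a k ⟩
      (k + a) + suc a           ≡⟨ cong (_+ suc a) (floorPhi∘floorPhi k) ⟨
      floorPhi a + suc a        ∎))
  , sym (≡+⇒∸≡ {floorPhi2 b} {floorPhi2 a} {suc b} (begin
      floorPhi b + b            ≡⟨ cong (_+ b) (floorPhi∘floorPhi2 k) ⟩
      (a + b) + b               ≡⟨ q-identity a k ⟩
      ((k + a) + a) + suc b     ≡⟨ cong (λ x → (x + a) + suc b) (floorPhi∘floorPhi k) ⟨
      (floorPhi a + a) + suc b  ∎))
  where
  open ≡-Reasoning
  a = floorPhi (suc k)
  b = floorPhi2 (suc k)
  p-identity : ∀ a k → a + (a + suc k) ≡ (k + a) + suc a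
  p-identity = solve-∀
  q-identity : ∀ a k → (a + (a + suc k)) + (a + suc k) ≡ ((k + a) + a) + suc (a + suc k)
  q-identity = solve-∀

splittingPair⇒difference : ∀ {p q} → SplittingPair p q →
  ∃[ m ] ∃[ n ] (m < n × p ≡ floorPhi n ∸ floorPhi m × q ≡ floorPhi2 n ∸ floorPhi2 m)
splittingPair⇒difference (n , 0<n , inj₁ wythoff) = 0 , n , 0<n , wythoff
splittingPair⇒difference (suc k , _ , inj₂ (refl , refl)) =
  floorPhi (suc k) , floorPhi2 (suc k) , m<m+n (floorPhi (suc k)) z<s , dualWythoffPair-difference k

proposition4p4 : (p q : ℕ) → 1 ≤ p → 1 ≤ q →
    (SplittingPair p q →
      ∃[ m ] ∃[ n ] (m < n × p ≡ floorPhi n ∸ floorPhi m × q ≡ floorPhi2 n ∸ floorPhi2 m))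
    × (∃[ m ] ∃[ n ] (m < n × p ≡ floorPhi n ∸ floorPhi m × q ≡ floorPhi2 n ∸ floorPhi2 m) →
      SplittingPair p q)
proposition4p4 p q _ _ =
    splittingPair⇒difference
  , λ (m , n , m<n , p≡ , q≡) → subst₂ SplittingPair (sym p≡) (sym q≡) (difference⇒splittingPair m<n)
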